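{- Let $G$ be a finite Abelian group with $|G|\ge3$. For every $n$, the maximum size of a $G$-ensemble with $n$ vectors (in any dimension $d$) equals $\operatorname{NRD}(\operatorname{3LIN}^*_G\mid\operatorname{3LIN}_G,n)$.
   Context: $\operatorname{3LIN}_G=\{(x,y,z)\in G^3:x+y+z=0\}$, $\operatorname{3LIN}^*_G=\operatorname{3LIN}_G\setminus\{(0,0,0)\}$. A $G$-ensemble consists of $d\in\mathbb{N}$, a set $V\subseteq G^d$ of vectors, a set $E\subseteq V^3$ of edges with $v_1+v_2+v_3=0$ for every $(v_1,v_2,v_3)\in E$, and group homomorphisms $\phi_e:G^d\to G$ for $e\in E$, such that for all $e,e'\in E$, $\phi_e$ maps all three vectors of $e'$ to $0$ if and only if $e=e'$; its size is $|E|$, and it has $n$ vectors if $|V|=n$. For $P\subseteq Q\subseteq G^3$, an instance $(X,Y)$ of $\operatorname{CSP}(P)$ (finite variable set $X$, clauses $Y\subseteq X^3$) is $Q$-conditionally non-redundant if for each $y\in Y$ there is $\sigma_y:X\to G$ with $(\sigma_y(y_1),\sigma_y(y_2),\sigma_y(y_3))\in Q\setminus P$ and $(\sigma_y(y'_1),\sigma_y(y'_2),\sigma_y(y'_3))\in P$ for all $y'\in Y\setminus\{y\}$; $\operatorname{NRD}(P\mid Q,n)$ is the maximum $|Y|$ over such instances with $|X|=n$. -}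

module Defs where

open import Level using (Level; _⊔_)
open import Algebra.Bundles using (AbelianGroup)
open import Data.Nat using (ℕ; _≤_)
open import Data.Fin using (Fin)
open import Data.Product using (Σ; ∃; _×_; _,_; proj₁; proj₂)
open import Relation.Nullary using (¬_)
open import Relation.Binary.PropositionalEquality using (_≡_)
open import Function.Bundles using (_⇔_)

Triple : ∀ {a} → Set a → Set a
Triple A = A × A × A

IsMaximum : ∀ {p} → (ℕ → Set p) → ℕ → Set p
IsMaximum S m = S m × (∀ k → S k → k ≤ m)

InjectiveFin : ∀ {a} {m : ℕ} {A : Set a} → (Fin m → A) → Set a
InjectiveFin {m = m} f = ∀ (i j : Fin m) → f i ≡ f j → i ≡ j

module _ {c ℓ : Level} (G : AbelianGroup c ℓ) where
  open AbelianGroup G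

  record HasCardinality (k : ℕ) : Set (c ⊔ ℓ) where
    field
      enum       : Fin k → Carrier
      enum-inj   : ∀ i j → enum i ≈ enum j → i ≡ j
      enum-surj  : ∀ x → ∃ λ i → enum i ≈ x

  FiniteAtLeast3 : Set (c ⊔ ℓ)
  FiniteAtLeast3 = Σ ℕ λ k → HasCardinality k × (3 ≤ k)

  Vect : ℕ → Set c
  Vect d = Fin d → Carrier

  _≈ᵥ_ : ∀ {d} → Vect d → Vect d → Set ℓ
  u ≈ᵥ v = ∀ i → u i ≈ v i

  _+ᵥ_ : ∀ {d} → Vect d → Vect d → Vect d
  (u +ᵥ v) i = u i ∙ v i

  0ᵥ : ∀ {d} → Vect d
  0ᵥ i = ε

  record IsHom {d : ℕ} (φ : Vect d → Carrier) : Set (c ⊔ ℓ) where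
    field
      cong    : ∀ {u v} → u ≈ᵥ v → φ u ≈ φ v
      hom     : ∀ u v → φ (u +ᵥ v) ≈ φ u ∙ φ v

  3LIN : Triple Carrier → Set ℓ
  3LIN (x , y , z) = (x ∙ y) ∙ z ≈ ε

  IsZeroTriple : Triple Carrier → Set ℓ
  IsZeroTriple (x , y , z) = (x ≈ ε) × (y ≈ ε) × (z ≈ ε)

  3LIN* : Triple Carrier → Set ℓ
  3LIN* t = 3LIN t × ¬ IsZeroTriple t

  mapT : ∀ {a b} {A : Set a} {B : Set b} → (A → B) → Triple A → Triple B
  mapT f (x , y , z) = (f x , f y , f z)

  SumsToZero : ∀ {d} → Triple (Vect d) → Set ℓ
  SumsToZero (u , v , w) = ((u +ᵥ v) +ᵥ w) ≈ᵥ 0ᵥ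

  AllKilled : ∀ {d} → (Vect d → Carrier) → Triple (Vect d) → Set ℓ
  AllKilled φ (u , v , w) = (φ u ≈ ε) × (φ v ≈ ε) × (φ w ≈ ε)

  -- A G-ensemble with n vectors (V = image of the injective map vec,
  -- so |V| = n) and size m (E = image of the injective map edge, |E| = m).
  -- Edges are triples of (indices of) vectors of V.
  record Ensemble (n m : ℕ) : Set (c ⊔ ℓ) where
    field
      d        : ℕ
      vec      : Fin n → Vect d
      vec-inj  : ∀ i j → vec i ≈ᵥ vec j → i ≡ j
      edge     : Fin m → Triple (Fin n)
      edge-inj : InjectiveFin edge
      φ        : Fin m → Vect d → Carrier
      φ-hom    : ∀ e → IsHom (φ e)
      edge-sum : ∀ e → SumsToZero (mapT vec (edge e))
      φ-sep    : ∀ e e' → AllKilled (φ e) (mapT vec (edge e')) ⇔ (e ≡ e')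

  EnsembleSize : ℕ → ℕ → Set (c ⊔ ℓ)
  EnsembleSize n m = Ensemble n m

  -- Q-conditionally non-redundant instance of CSP(P), with variable set
  -- X = Fin n and clause set Y = image of the injective map clause (|Y| = m).

  record CondNonRedundant {p q} (P : Triple Carrier → Set p)
         (Q : Triple Carrier → Set q) (n m : ℕ) : Set (c ⊔ ℓ ⊔ p ⊔ q) where
    field
      clause     : Fin m → Triple (Fin n)
      clause-inj : InjectiveFin clause
      σ          : Fin m → Fin n → Carrier
      σ-own      : ∀ y → Q (mapT (σ y) (clause y)) × ¬ P (mapT (σ y) (clause y))
      σ-other    : ∀ y y' → ¬ (y' ≡ y) → P (mapT (σ y) (clause y'))

  IsNRD : ∀ {p q} (P : Triple Carrier → Set p) (Q : Triple Carrier → Set q)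
          (n m : ℕ) → Set (c ⊔ ℓ ⊔ p ⊔ q)
  IsNRD P Q n m = IsMaximum (CondNonRedundant P Q n) m

{-# OPTIONS --safe #-}
module Submission where

-- An ensemble yields a non-redundant instance on the same n variables via σ_e(x) = φ_e(v_x):
-- homomorphisms preserve 3LIN, and φ_e kills the vectors of e′ exactly when e = e′.
-- Conversely, a non-redundant instance yields the vectors v_x = (σ_y(x))_y ∈ G^m with φ_y the
-- y-th coordinate projection; variables with equal signature are merged into a representative,
-- which is all the edges use, and the other variables are told apart by extra coordinates
-- carrying a nonzero element of G. So both problems attain the same sizes, and a maximum
-- exists because, G being finite, non-redundancy is decidable and m ≤ n³.

open import Defs
open import Level using (Level; _⊔_) renaming (suc to lsuc)
open import Algebra.Bundles using (AbelianGroup)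
open import Data.Bool using (Bool; T)
open import Data.Empty using (⊥-elim)
open import Data.Fin using (Fin; zero; suc; splitAt; combine; _↑ˡ_)
open import Data.Fin.Properties using (_≟_; any?; all?; combine-injective; injective⇒≤)
open import Data.Nat using (ℕ; zero; suc; _+_; _*_; _≤_; s≤s; s≤s⁻¹)
open import Data.Nat.Properties using (≤∧≢⇒<; n≤1+n; ≤-trans)
open import Data.Product using (Σ; ∃; _×_; _,_; proj₁; proj₂)
open import Data.Product.Relation.Binary.Pointwise.NonDependent using (×-setoid)
import Data.Product.Properties as Product
open import Data.Sum using (inj₁; inj₂)
open import Data.Vec using (Vec; []; _∷_; lookup; tabulate)
open import Data.Vec.Properties using (lookup∘tabulate; tabulate-cong)
open import Data.Vec.Functional using (Vector; _++_)
open import Data.Vec.Functional.Properties using (lookup-++ˡ)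
open import Data.Vec.Functional.Relation.Binary.Pointwise using (Pointwise)
import Data.Vec.Functional.Relation.Binary.Pointwise.Properties as Pointwise
open import Function.Base using (_∘_)
open import Function.Bundles using (_⇔_; mk⇔; Equivalence)
open import Relation.Binary.Core using (Rel)
open import Relation.Binary.Definitions using (Decidable; _Respects_)
open import Relation.Binary.Structures using (IsDecEquivalence)
open import Relation.Binary.Bundles using (Setoid)
import Relation.Binary.Construct.On as On
open import Relation.Binary.PropositionalEquality as ≡ using (_≡_; _≢_)
open import Relation.Nullary using (¬_; Dec; yes; no; does)
open import Relation.Nullary.Decidable
  using (T?; isYes≗does; toWitness; fromWitness; does-⇔; map′; ¬?; _×-dec_; _→-dec_)
open import Relation.Unary as U using (Pred)

Searchable : (p : Level) → Set → Set (lsuc p)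
Searchable p A = ∀ {P : Pred A p} → U.Decidable P → Dec (∃ P)

Fin-searchable : ∀ {p} n → Searchable p (Fin n)
Fin-searchable n = any?

×-searchable : ∀ {p} {A B : Set} →
  Searchable p A → Searchable p B → Searchable p (A × B)
×-searchable search-A search-B P? =
  map′ (λ (a , b , pab) → (a , b) , pab) (λ ((a , b) , pab) → a , b , pab)
       (search-A (λ a → search-B (λ b → P? (a , b))))

Vec-searchable : ∀ {p} {A : Set} → Searchable p A → ∀ m → Searchable p (Vec A m)
Vec-searchable search-A zero P? =
  map′ ([] ,_) (λ { ([] , p[]) → p[] }) (P? [])
Vec-searchable search-A (suc m) P? =
  map′ (λ (a , as , p) → a ∷ as , p) (λ { (a ∷ as , p) → a , as , p })
       (search-A (λ a → Vec-searchable search-A m (λ as → P? (a ∷ as))))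

maximum-up-to : ∀ {p} (S : Pred ℕ p) → U.Decidable S → S 0 → ∀ B →
  ∃ λ m → S m × (∀ k → S k → k ≤ B → k ≤ m)
maximum-up-to S S? s₀ zero = zero , s₀ , λ _ _ k≤0 → k≤0
maximum-up-to S S? s₀ (suc B) with S? (suc B)
... | yes s = suc B , s , λ _ _ k≤1+B → k≤1+B
... | no ¬s =
  let m , sₘ , below = maximum-up-to S S? s₀ B
  in m , sₘ , λ k sₖ k≤1+B →
       below k sₖ (s≤s⁻¹ (≤∧≢⇒< k≤1+B (λ { ≡.refl → ¬s sₖ })))

bounded-maximum : ∀ {p} (S : Pred ℕ p) → U.Decidable S → S 0 →
  ∀ B → (∀ k → S k → k ≤ B) → ∃ (IsMaximum S)
bounded-maximum S S? s₀ B bounded =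
  let m , sₘ , below = maximum-up-to S S? s₀ B
  in m , sₘ , λ k sₖ → below k sₖ (bounded k sₖ)

injective-triples-≤ : ∀ {m n} {f : Fin m → Triple (Fin n)} → InjectiveFin f → m ≤ n * (n * n)
injective-triples-≤ f-inj = injective⇒≤ (λ {i} {j} eq → f-inj i j (encode-injective eq))
  where
  encode : ∀ {n} → Triple (Fin n) → Fin (n * (n * n))
  encode (a , b , c) = combine a (combine b c)

  encode-injective : ∀ {n} {t t′ : Triple (Fin n)} → encode t ≡ encode t′ → t ≡ t′
  encode-injective {t = a , b , c} {a′ , b′ , c′} eq
    with combine-injective a (combine b c) a′ (combine b′ c′) eq
  ... | ≡.refl , eq′ with combine-injective b c b′ c′ eq′
  ... | ≡.refl , ≡.refl = ≡.refl

module Representatives {n ℓ} {_~_ : Rel (Fin n) ℓ} (~-isDecEquivalence : IsDecEquivalence _~_) where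
  open IsDecEquivalence ~-isDecEquivalence renaming (_≟_ to _~?_)

  -- Classes are Boolean vectors, so equivalent elements have propositionally equal classes
  -- and the representative picked from a class does not depend on the element.
  class : Fin n → Vec Bool n
  class x = tabulate (λ z → does (z ~? x))

  class-cong : ∀ {x y} → x ~ y → class x ≡ class y
  class-cong x~y = tabulate-cong λ z →
    does-⇔ (mk⇔ (λ z~x → trans z~x x~y) (λ z~y → trans z~y (sym x~y))) (z ~? _) (z ~? _)

  ∈-class⇒~ : ∀ {x z} → T (lookup (class x) z) → z ~ x
  ∈-class⇒~ {x} {z} z∈ = toWitness {a? = z ~? x}
    (≡.subst T (≡.trans (lookup∘tabulate _ z) (≡.sym (isYes≗does (z ~? x)))) z∈)

  ∈-class : ∀ x → T (lookup (class x) x)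
  ∈-class x = ≡.subst T (≡.trans (isYes≗does (x ~? x)) (≡.sym (lookup∘tabulate _ x)))
    (fromWitness {a? = x ~? x} refl)

  choose : Vec Bool n → Fin n → Fin n
  choose s z with any? (λ w → T? (lookup s w))
  ... | yes (w , _) = w
  ... | no _ = z

  choose-∈ : ∀ s z → T (lookup s z) → T (lookup s (choose s z))
  choose-∈ s z z∈s with any? (λ w → T? (lookup s w))
  ... | yes (_ , w∈s) = w∈s
  ... | no ∄ = ⊥-elim (∄ (z , z∈s))

  choose-irrelevant : ∀ s z z′ → T (lookup s z) → choose s z ≡ choose s z′
  choose-irrelevant s z z′ z∈s with any? (λ w → T? (lookup s w))
  ... | yes _ = ≡.refl
  ... | no ∄ = ⊥-elim (∄ (z , z∈s))

  rep : Fin n → Fin n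
  rep x = choose (class x) x

  rep-~ : ∀ x → rep x ~ x
  rep-~ x = ∈-class⇒~ (choose-∈ (class x) x (∈-class x))

  rep-cong : ∀ {x y} → x ~ y → rep x ≡ rep y
  rep-cong {x} {y} x~y = ≡.trans (choose-irrelevant (class x) x y (∈-class x))
                                 (≡.cong (λ s → choose s y) (class-cong x~y))

  rep-idem : ∀ x → rep (rep x) ≡ rep x
  rep-idem x = rep-cong (rep-~ x)

module _ {c ℓ} (G : AbelianGroup c ℓ) where
  open AbelianGroup G
  open import Relation.Binary.Reasoning.Setoid setoid

  open Setoid (×-setoid setoid (×-setoid setoid setoid))
    using () renaming (_≈_ to _≈₃_; sym to ≈₃-sym)

  CNR : ℕ → ℕ → Set (c ⊔ ℓ)
  CNR = CondNonRedundant G (3LIN* G) (3LIN G)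

  mapT-cong : ∀ {A : Set} {f g : A → Carrier} → (∀ x → f x ≈ g x) →
    ∀ t → mapT G f t ≈₃ mapT G g t
  mapT-cong f≈g (a , b , c) = f≈g a , f≈g b , f≈g c

  3LIN-resp : 3LIN G Respects _≈₃_
  3LIN-resp (x≈ , y≈ , z≈) sum≈ε = trans (sym (∙-cong (∙-cong x≈ y≈) z≈)) sum≈ε

  IsZeroTriple-resp : IsZeroTriple G Respects _≈₃_
  IsZeroTriple-resp (x≈ , y≈ , z≈) (x≈ε , y≈ε , z≈ε) =
    trans (sym x≈) x≈ε , trans (sym y≈) y≈ε , trans (sym z≈) z≈ε

  3LIN*-resp : 3LIN* G Respects _≈₃_
  3LIN*-resp t≈ (lin , nonzero) = 3LIN-resp t≈ lin , nonzero ∘ IsZeroTriple-resp (≈₃-sym t≈)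

  IsZeroTriple⇒3LIN : ∀ {t} → IsZeroTriple G t → 3LIN G t
  IsZeroTriple⇒3LIN {x , y , z} (x≈ε , y≈ε , z≈ε) = begin
    (x ∙ y) ∙ z ≈⟨ ∙-cong (∙-cong x≈ε y≈ε) z≈ε ⟩
    (ε ∙ ε) ∙ ε ≈⟨ ∙-cong (identityˡ ε) refl ⟩
    ε ∙ ε       ≈⟨ identityˡ ε ⟩
    ε           ∎

  IsHom-ε : ∀ {d} {φ : Vect G d → Carrier} → IsHom G φ → φ (0ᵥ G) ≈ ε
  IsHom-ε {φ = φ} hom = identityˡ-unique (φ (0ᵥ G)) (φ (0ᵥ G)) (begin
    φ (0ᵥ G) ∙ φ (0ᵥ G)   ≈⟨ IsHom.hom hom (0ᵥ G) (0ᵥ G) ⟨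
    φ (_+ᵥ_ G (0ᵥ G) (0ᵥ G)) ≈⟨ IsHom.cong hom (λ _ → identityˡ ε) ⟩
    φ (0ᵥ G)              ∎)
    where open import Algebra.Properties.Group group using (identityˡ-unique)

  IsHom-3LIN : ∀ {d} {φ : Vect G d → Carrier} → IsHom G φ →
    ∀ {t} → SumsToZero G t → 3LIN G (mapT G φ t)
  IsHom-3LIN {φ = φ} hom {u , v , w} sum≈0 = begin
    (φ u ∙ φ v) ∙ φ w             ≈⟨ ∙-cong (IsHom.hom hom u v) refl ⟨
    φ (_+ᵥ_ G u v) ∙ φ w          ≈⟨ IsHom.hom hom (_+ᵥ_ G u v) w ⟨
    φ (_+ᵥ_ G (_+ᵥ_ G u v) w)     ≈⟨ IsHom.cong hom sum≈0 ⟩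
    φ (0ᵥ G)                      ≈⟨ IsHom-ε hom ⟩
    ε                             ∎

  ++-sumsToZero : ∀ {d d′} {u v w : Vect G d} {u′ v′ w′ : Vect G d′} →
    SumsToZero G (u , v , w) → SumsToZero G (u′ , v′ , w′) →
    SumsToZero G (u ++ u′ , v ++ v′ , w ++ w′)
  ++-sumsToZero {d} sum≈0 sum′≈0 i with splitAt d i
  ... | inj₁ j = sum≈0 j
  ... | inj₂ j = sum′≈0 j

  Ensemble⇒CondNonRedundant : ∀ {n m} → Ensemble G n m → CNR n m
  Ensemble⇒CondNonRedundant {n} {m} E = record
    { clause     = edge
    ; clause-inj = edge-inj
    ; σ          = σ
    ; σ-own      = λ y → σ-3LIN y y ,
                         λ (_ , nonzero) → nonzero (Equivalence.from (φ-sep y y) ≡.refl)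
    ; σ-other    = λ y y′ y′≢y → σ-3LIN y y′ , y′≢y ∘ ≡.sym ∘ Equivalence.to (φ-sep y y′)
    }
    where
    open Ensemble E
    σ : Fin m → Fin n → Carrier
    σ y x = φ y (vec x)
    σ-3LIN : ∀ y y′ → 3LIN G (mapT G (σ y) (edge y′))
    σ-3LIN y y′ = IsHom-3LIN (φ-hom y) (edge-sum y′)

  module _ (_≈?_ : Decidable _≈_) where

    IsZeroTriple? : U.Decidable (IsZeroTriple G)
    IsZeroTriple? (x , y , z) = (x ≈? ε) ×-dec ((y ≈? ε) ×-dec (z ≈? ε))

    3LIN? : U.Decidable (3LIN G)
    3LIN? (x , y , z) = ((x ∙ y) ∙ z) ≈? ε

    3LIN*? : U.Decidable (3LIN* G)
    3LIN*? t = 3LIN? t ×-dec ¬? (IsZeroTriple? t)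

    3LIN∖3LIN*⇒IsZeroTriple : ∀ {t} → 3LIN G t → ¬ 3LIN* G t → IsZeroTriple G t
    3LIN∖3LIN*⇒IsZeroTriple {t} lin not-lin* with IsZeroTriple? t
    ... | yes is-zero = is-zero
    ... | no nonzero = ⊥-elim (not-lin* (lin , nonzero))

    module FromCondNonRedundant {g : Carrier} (g≉ε : ¬ g ≈ ε) {n m} (C : CNR n m) where
      open CondNonRedundant C

      signature : Fin n → Vector Carrier m
      signature x y = σ y x

      _~_ : Rel (Fin n) ℓ
      x ~ x′ = Pointwise _≈_ (signature x) (signature x′)

      ~-isDecEquivalence : IsDecEquivalence _~_
      ~-isDecEquivalence = On.isDecEquivalence signature
        (Pointwise.isDecEquivalence (record { isEquivalence = isEquivalence ; _≟_ = _≈?_ }) m)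

      open Representatives ~-isDecEquivalence

      -- Representatives get the zero marker, so edge sums are unaffected; a non-representative
      -- x gets g at coordinate x, which no other vector has.
      marker : Fin n → Vector Carrier n
      marker x j with rep x ≟ x | j ≟ x
      ... | no _ | yes _ = g
      ... | _    | _     = ε

      marker-rep : ∀ {x} → rep x ≡ x → ∀ j → marker x j ≈ ε
      marker-rep {x} is-rep j with rep x ≟ x | j ≟ x
      ... | yes _     | _ = refl
      ... | no not-rep | _ = ⊥-elim (not-rep is-rep)

      marker-self : ∀ {x} → rep x ≢ x → marker x x ≈ g
      marker-self {x} not-rep with rep x ≟ x | x ≟ x
      ... | yes is-rep | _     = ⊥-elim (not-rep is-rep)
      ... | no _       | yes _ = refl
      ... | no _       | no x≢x = ⊥-elim (x≢x ≡.refl)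

      marker-apart : ∀ {x j} → j ≢ x → marker x j ≈ ε
      marker-apart {x} {j} j≢x with rep x ≟ x | j ≟ x
      ... | yes _ | _       = refl
      ... | no _  | yes j≡x = ⊥-elim (j≢x j≡x)
      ... | no _  | no _    = refl

      marker-separates : ∀ {x x′} → rep x ≢ x → Pointwise _≈_ (marker x) (marker x′) → x ≡ x′
      marker-separates {x} {x′} not-rep markers≈ with x ≟ x′
      ... | yes x≡x′ = x≡x′
      ... | no x≢x′ = ⊥-elim (g≉ε (begin
        g           ≈⟨ marker-self not-rep ⟨
        marker x x  ≈⟨ markers≈ x ⟩
        marker x′ x ≈⟨ marker-apart x≢x′ ⟩
        ε           ∎))

      vec : Fin n → Vect G (m + n)
      vec x = signature x ++ marker x

      vec-injective : ∀ x x′ → _≈ᵥ_ G (vec x) (vec x′) → x ≡ x′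
      vec-injective x x′ vecs≈ with Pointwise.++⁻ _≈_ (signature x) (signature x′) vecs≈
                                   | rep x ≟ x | rep x′ ≟ x′
      ... | _ , markers≈ | no not-rep | _ = marker-separates not-rep markers≈
      ... | _ , markers≈ | _ | no not-rep′ =
        ≡.sym (marker-separates not-rep′ (sym ∘ markers≈))
      ... | signatures≈ , _ | yes is-rep | yes is-rep′ =
        ≡.trans (≡.sym is-rep) (≡.trans (rep-cong signatures≈) is-rep′)

      edge : Fin m → Triple (Fin n)
      edge y = mapT G rep (clause y)

      φ : Fin m → Vect G (m + n) → Carrier
      φ y v = v (y ↑ˡ n)

      φ-vec-rep : ∀ y x → φ y (vec (rep x)) ≈ σ y x
      φ-vec-rep y x =
        trans (reflexive (lookup-++ˡ (signature (rep x)) (marker (rep x)) y)) (rep-~ x y)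

      σ-3LIN : ∀ y y′ → 3LIN G (mapT G (σ y) (clause y′))
      σ-3LIN y y′ with y′ ≟ y
      ... | yes ≡.refl = proj₁ (σ-own y)
      ... | no y′≢y = proj₁ (σ-other y y′ y′≢y)

      σ-zero⇔ : ∀ y y′ → IsZeroTriple G (mapT G (σ y) (clause y′)) ⇔ (y ≡ y′)
      σ-zero⇔ y y′ = mk⇔ to from
        where
        to : IsZeroTriple G (mapT G (σ y) (clause y′)) → y ≡ y′
        to is-zero with y′ ≟ y
        ... | yes y′≡y = ≡.sym y′≡y
        ... | no y′≢y = ⊥-elim (proj₂ (σ-other y y′ y′≢y) is-zero)
        from : y ≡ y′ → IsZeroTriple G (mapT G (σ y) (clause y′))
        from ≡.refl = 3LIN∖3LIN*⇒IsZeroTriple (proj₁ (σ-own y)) (proj₂ (σ-own y))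

      φ-sep : ∀ y y′ → AllKilled G (φ y) (mapT G vec (edge y′)) ⇔ (y ≡ y′)
      φ-sep y y′ = mk⇔
        (Equivalence.to (σ-zero⇔ y y′) ∘ IsZeroTriple-resp killed≈σ)
        (IsZeroTriple-resp (≈₃-sym killed≈σ) ∘ Equivalence.from (σ-zero⇔ y y′))
        where
        killed≈σ : mapT G (φ y) (mapT G vec (edge y′)) ≈₃ mapT G (σ y) (clause y′)
        killed≈σ = mapT-cong (φ-vec-rep y) (clause y′)

      edge-sum : ∀ y → SumsToZero G (mapT G vec (edge y))
      edge-sum y′ = ++-sumsToZero
        (λ y → 3LIN-resp (≈₃-sym (mapT-cong (λ x → rep-~ x y) (clause y′))) (σ-3LIN y y′))
        (λ j → IsZeroTriple⇒3LIN (mapT-cong (λ x → marker-rep (rep-idem x) j) (clause y′)))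

      edge-inj : InjectiveFin edge
      edge-inj y y′ edges≡ = Equivalence.to (φ-sep y y′)
        (≡.subst (λ t → AllKilled G (φ y) (mapT G vec t)) edges≡
                 (Equivalence.from (φ-sep y y) ≡.refl))

      ensemble : Ensemble G n m
      ensemble = record
        { d = m + n
        ; vec = vec ; vec-inj = vec-injective
        ; edge = edge ; edge-inj = edge-inj
        ; φ = φ ; φ-hom = λ y → record { cong = λ v≈ → v≈ (y ↑ˡ n) ; hom = λ _ _ → refl }
        ; edge-sum = edge-sum ; φ-sep = φ-sep
        }

  module _ {p q} {P : Pred (Triple Carrier) p} {Q : Pred (Triple Carrier) q} {n m : ℕ} where

    IsCondNonRedundant : (Fin m → Triple (Fin n)) → (Fin m → Fin n → Carrier) → Set (p ⊔ q)
    IsCondNonRedundant clause σ =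
      InjectiveFin clause ×
      (∀ y → Q (mapT G (σ y) (clause y)) × ¬ P (mapT G (σ y) (clause y))) ×
      (∀ y y′ → ¬ y′ ≡ y → P (mapT G (σ y) (clause y′)))

    IsCondNonRedundant⇒CondNonRedundant : ∀ {clause σ} →
      IsCondNonRedundant clause σ → CondNonRedundant G P Q n m
    IsCondNonRedundant⇒CondNonRedundant {clause} {σ} (clause-inj , σ-own , σ-other) = record
      { clause = clause ; clause-inj = clause-inj ; σ = σ ; σ-own = σ-own ; σ-other = σ-other }

    CondNonRedundant⇒IsCondNonRedundant : (C : CondNonRedundant G P Q n m) →
      IsCondNonRedundant (CondNonRedundant.clause C) (CondNonRedundant.σ C)
    CondNonRedundant⇒IsCondNonRedundant C = clause-inj , σ-own , σ-other
      where open CondNonRedundant C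

    IsCondNonRedundant-resp : P Respects _≈₃_ → Q Respects _≈₃_ →
      ∀ {clause clause′ σ σ′} → (∀ y → clause y ≡ clause′ y) → (∀ y x → σ y x ≈ σ′ y x) →
      IsCondNonRedundant clause σ → IsCondNonRedundant clause′ σ′
    IsCondNonRedundant-resp P-resp Q-resp {clause} {clause′} {σ} {σ′} clause≡ σ≈
                            (clause-inj , σ-own , σ-other) =
      (λ y y′ eq → clause-inj y y′ (≡.trans (clause≡ y) (≡.trans eq (≡.sym (clause≡ y′))))) ,
      (λ y → Q-resp (instances≈ y y) (proj₁ (σ-own y)) ,
             proj₂ (σ-own y) ∘ P-resp (≈₃-sym (instances≈ y y))) ,
      (λ y y′ y′≢y → P-resp (instances≈ y y′) (σ-other y y′ y′≢y))
      where
      instances≈ : ∀ y y′ → mapT G (σ y) (clause y′) ≈₃ mapT G (σ′ y) (clause′ y′)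
      instances≈ y y′ = ≡.subst (λ t → mapT G (σ y) (clause y′) ≈₃ mapT G (σ′ y) t)
                                (clause≡ y′) (mapT-cong (σ≈ y) (clause y′))

    IsCondNonRedundant? : U.Decidable P → U.Decidable Q →
      ∀ clause σ → Dec (IsCondNonRedundant clause σ)
    IsCondNonRedundant? P? Q? clause σ =
      all? (λ y → all? λ y′ → triple≟ (clause y) (clause y′) →-dec (y ≟ y′)) ×-dec
      (all? (λ y → Q? _ ×-dec ¬? (P? _)) ×-dec
       all? (λ y → all? λ y′ → ¬? (y′ ≟ y) →-dec P? _))
      where
      triple≟ : (t t′ : Triple (Fin n)) → Dec (t ≡ t′)
      triple≟ = Product.≡-dec _≟_ (Product.≡-dec _≟_ _≟_)

  CondNonRedundant-empty : ∀ {p q} {P : Pred (Triple Carrier) p} {Q : Pred (Triple Carrier) q} {n} →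
    CondNonRedundant G P Q n 0
  CondNonRedundant-empty = record
    { clause = λ () ; clause-inj = λ () ; σ = λ () ; σ-own = λ () ; σ-other = λ () }

  CondNonRedundant-≤ : ∀ {p q} {P : Pred (Triple Carrier) p} {Q : Pred (Triple Carrier) q} {n m} →
    CondNonRedundant G P Q n m → m ≤ n * (n * n)
  CondNonRedundant-≤ C = injective-triples-≤ (CondNonRedundant.clause-inj C)

  module Finite {k} (card : HasCardinality G k) where
    open HasCardinality card

    code : Carrier → Fin k
    code x = proj₁ (enum-surj x)

    enum-code : ∀ x → enum (code x) ≈ x
    enum-code x = proj₂ (enum-surj x)

    _≈?_ : Decidable _≈_
    x ≈? y = map′ code≡⇒≈ ≈⇒code≡ (code x ≟ code y)
      where
      code≡⇒≈ : code x ≡ code y → x ≈ y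
      code≡⇒≈ codes≡ = begin
        x              ≈⟨ enum-code x ⟨
        enum (code x)  ≡⟨ ≡.cong enum codes≡ ⟩
        enum (code y)  ≈⟨ enum-code y ⟩
        y              ∎
      ≈⇒code≡ : x ≈ y → code x ≡ code y
      ≈⇒code≡ x≈y = enum-inj _ _ (trans (enum-code x) (trans x≈y (sym (enum-code y))))

    nonzero-element : 2 ≤ k → Σ Carrier λ g → ¬ g ≈ ε
    nonzero-element (s≤s (s≤s _)) with enum zero ≈? ε
    ... | no enum0≉ε = enum zero , enum0≉ε
    ... | yes enum0≈ε = enum (suc zero) , λ enum1≈ε →
      0≢1 (enum-inj zero (suc zero) (trans enum0≈ε (sym enum1≈ε)))
      where
      0≢1 : zero ≢ suc zero
      0≢1 ()

    CondNonRedundant? : ∀ {p q} {P : Pred (Triple Carrier) p} {Q : Pred (Triple Carrier) q} →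
      U.Decidable P → U.Decidable Q → P Respects _≈₃_ → Q Respects _≈₃_ →
      ∀ n m → Dec (CondNonRedundant G P Q n m)
    CondNonRedundant? {p} {q} {P} {Q} P? Q? P-resp Q-resp n m =
      map′ (λ ((clauses , codes) , valid) → IsCondNonRedundant⇒CondNonRedundant
                                               {clause = lookup clauses} {σ = decode codes} valid)
           encode
           (candidates (λ (clauses , codes) →
              IsCondNonRedundant? P? Q? (lookup clauses) (decode codes)))
      where
      Candidate : Set
      Candidate = Vec (Triple (Fin n)) m × Vec (Vec (Fin k) n) m

      candidates : Searchable (p ⊔ q) Candidate
      candidates = ×-searchable (Vec-searchable triples m) (Vec-searchable assignments m)
        where
        triples : Searchable (p ⊔ q) (Triple (Fin n))
        triples = ×-searchable (Fin-searchable n)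
                               (×-searchable (Fin-searchable n) (Fin-searchable n))
        assignments : Searchable (p ⊔ q) (Vec (Fin k) n)
        assignments = Vec-searchable (Fin-searchable k) n

      decode : Vec (Vec (Fin k) n) m → Fin m → Fin n → Carrier
      decode codes y x = enum (lookup (lookup codes y) x)

      encode : CondNonRedundant G P Q n m →
        ∃ λ ((clauses , codes) : Candidate) →
          IsCondNonRedundant {P = P} {Q} (lookup clauses) (decode codes)
      encode C = (tabulate clause , codes) ,
        IsCondNonRedundant-resp P-resp Q-resp
          (λ y → ≡.sym (lookup∘tabulate clause y)) decode-codes
          (CondNonRedundant⇒IsCondNonRedundant C)
        where
        open CondNonRedundant C
        codes : Vec (Vec (Fin k) n) m
        codes = tabulate (λ y → tabulate (λ x → code (σ y x)))
        decode-codes : ∀ y x → σ y x ≈ decode codes y x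
        decode-codes y x = begin
          σ y x
            ≈⟨ enum-code (σ y x) ⟨
          enum (code (σ y x))
            ≡⟨ ≡.cong enum (lookup∘tabulate _ x) ⟨
          enum (lookup (tabulate (λ x → code (σ y x))) x)
            ≡⟨ ≡.cong (λ v → enum (lookup v x)) (lookup∘tabulate _ y) ⟨
          decode codes y x
            ∎

    CNR-maximum : ∀ n → ∃ (IsMaximum (CNR n))
    CNR-maximum n = bounded-maximum (CNR n)
      (CondNonRedundant? (3LIN*? _≈?_) (3LIN? _≈?_) 3LIN*-resp 3LIN-resp n)
      CondNonRedundant-empty (n * (n * n)) (λ _ → CondNonRedundant-≤)

    CondNonRedundant⇒Ensemble : 2 ≤ k → ∀ {n m} → CNR n m → Ensemble G n m
    CondNonRedundant⇒Ensemble 2≤k = FromCondNonRedundant.ensemble _≈?_ (proj₂ (nonzero-element 2≤k))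

proposition6p6 : {c ℓ : Level} (G : AbelianGroup c ℓ) → FiniteAtLeast3 G →
    (n : ℕ) → Σ ℕ λ m →
      IsMaximum (EnsembleSize G n) m × IsNRD G (3LIN* G) (3LIN G) n m
proposition6p6 G (k , card , 3≤k) n =
  let m , cnr , cnr-max = CNR-maximum n
  in m , (CondNonRedundant⇒Ensemble 2≤k cnr , λ m′ E → cnr-max m′ (Ensemble⇒CondNonRedundant G E))
       , (cnr , cnr-max)
  where
  open Finite G card
  2≤k : 2 ≤ k
  2≤k = ≤-trans (n≤1+n 2) 3≤k
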